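{- Let $a\in\mathbb{N}$, $a\ge3$, $S=\langle a,a+1,a+2\rangle$, $L=\lfloor (a-1)/2\rfloor$, and let $\ell\in\mathbb{N}$ with $0\le\ell\le L$. Then: (1) $(a+2)L<\mathscr{L}_a$ and $S^\ell\subseteq S\cap\llbracket 0,\mathscr{L}_a)\!)$; (2) $S^\ell=\llbracket a\ell,(a+2)\ell\rrbracket$; (3) $S\cap\llbracket 0,(a+2)L\rrbracket=\bigcup_{\ell=0}^{L}S^\ell$, where the sets $S^0,S^1,\dots,S^L$ are pairwise disjoint.
   Context: $\mathbb{N}=\{0,1,2,\dots\}$. $S=\langle a,a+1,a+2\rangle=\{\alpha_1a+\alpha_2(a+1)+\alpha_3(a+2):\alpha_i\in\mathbb{N}\}$. $\operatorname{F}(r,S)=\{\alpha\in\mathbb{N}^3:\alpha_1a+\alpha_2(a+1)+\alpha_3(a+2)=r\}$, $|\alpha|=\alpha_1+\alpha_2+\alpha_3$, $\operatorname{L}(r,S)=\{|\alpha|:\alpha\in\operatorname{F}(r,S)\}$, and $S^\ell=\{r\in S:\operatorname{L}(r,S)=\{\ell\}\}$. $\mathscr{L}_a=\lfloor a/2\rfloor (a+2)$ if $a$ is even, and $\mathscr{L}_a=(\lfloor a/2\rfloor+2)a$ if $a$ is odd. $\llbracket x,y\rrbracket=\{n\in\mathbb{Z}:x\le n\le y\}$ and $\llbracket x,y)\!)=\{n\in\mathbb{Z}:x\le n<y\}$. -}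

module Defs where

open import Data.Nat using (ℕ; _+_; _*_; _∸_; _/_; _%_; _<_; _≤_)
open import Data.Product using (_×_; _,_; Σ; ∃)
open import Relation.Binary.PropositionalEquality using (_≡_)

Fact : Set
Fact = ℕ × ℕ × ℕ

InF : ℕ → ℕ → Fact → Set
InF a r (α₁ , α₂ , α₃) = α₁ * a + α₂ * (a + 1) + α₃ * (a + 2) ≡ r

len : Fact → ℕ
len (α₁ , α₂ , α₃) = α₁ + α₂ + α₃

InS : ℕ → ℕ → Set
InS a r = ∃ λ α → InF a r α

InLen : ℕ → ℕ → ℕ → Set
InLen a r n = ∃ λ α → InF a r α × len α ≡ n

InSell : ℕ → ℕ → ℕ → Set
InSell a ℓ r = InS a r × (∀ n → InLen a r n → n ≡ ℓ)

scrL : ℕ → ℕ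
scrL a with a % 2
... | 0 = (a / 2) * (a + 2)
... | _ = (a / 2 + 2) * a

{-# OPTIONS --safe #-}
-- A factorization α of r has a |α| ≤ r ≤ (a + 2) |α|, and conversely every
-- r ∈ ⟦a n, (a + 2) n⟧ has a factorization of length n.  The intervals ⟦a n, (a + 2) n⟧
-- are pairwise disjoint (and increasing) as long as 2 n < a, since then
-- (a + 2) n < a (n + 1).  For ℓ ≤ L = ⌊(a - 1)/2⌋ we have 2 ℓ < a, so the elements
-- with a length ℓ are exactly those of ⟦a ℓ, (a + 2) ℓ⟧ and they have no other length.
module Submission where

open import Defs
open import Data.Nat using (ℕ; zero; suc; _+_; _*_; _∸_; _/_; _%_; _<_; _≤_; s≤s)
open import Data.Nat.Properties
open import Data.Nat.DivMod using (m/n*n≤m; m≡m%n+[m/n]*n; m%n<n)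
open import Data.Nat.Tactic.RingSolver using (solve-∀; solve)
open import Data.List using (_∷_; [])
open import Data.Product using (_×_; _,_; ∃; proj₁; proj₂; uncurry)
open import Relation.Binary.PropositionalEquality
open import Relation.Nullary using (¬_)
open import Function.Bundles using (_⇔_; mk⇔)

InF⇒bounds : ∀ {a r} α → InF a r α → a * len α ≤ r × r ≤ (a + 2) * len α
InF⇒bounds {a} {r} (x , y , z) α∈F = lower , upper
  where
  split : ∀ x y z a → x * a + y * (a + 1) + z * (a + 2) ≡ a * (x + y + z) + (y + z * 2)
  split = solve-∀
  top : ∀ x y z a → a * (x + y + z) + (y + z * 2 + (x * 2 + y)) ≡ (a + 2) * (x + y + z)
  top = solve-∀
  r≡ : r ≡ a * (x + y + z) + (y + z * 2)
  r≡ = trans (sym α∈F) (split x y z a)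
  lower : a * (x + y + z) ≤ r
  lower = subst (a * (x + y + z) ≤_) (sym r≡) (m≤m+n _ _)
  upper : r ≤ (a + 2) * (x + y + z)
  upper = subst₂ _≤_ (sym r≡) (top x y z a) (+-monoʳ-≤ (a * (x + y + z)) (m≤m+n _ _))

InLen⇒bounds : ∀ {a r n} → InLen a r n → a * n ≤ r × r ≤ (a + 2) * n
InLen⇒bounds (α , α∈F , refl) = InF⇒bounds α α∈F

InLen-offset : ∀ a n t → t ≤ n * 2 → InLen a (a * n + t) n
InLen-offset a zero zero _ = (0 , 0 , 0) , solve (a ∷ []) , refl
InLen-offset a (suc n) zero _ =
  (suc n , 0 , 0) , solve (a ∷ n ∷ []) , trans (+-identityʳ _) (+-identityʳ _)
InLen-offset a (suc n) (suc zero) _ =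
  (n , 1 , 0) , solve (a ∷ n ∷ []) , trans (+-identityʳ _) (+-comm n 1)
InLen-offset a (suc n) (suc (suc t)) (s≤s (s≤s t≤2n))
  with InLen-offset a n t t≤2n
... | (x , y , z) , α∈F , refl = (x , y , suc z) , β∈F , +-suc (x + y) z
  where
  open ≡-Reasoning
  β∈F : InF a (a * suc n + suc (suc t)) (x , y , suc z)
  β∈F = begin
    x * a + y * (a + 1) + suc z * (a + 2)       ≡⟨ solve (a ∷ x ∷ y ∷ z ∷ []) ⟩
    x * a + y * (a + 1) + z * (a + 2) + (a + 2) ≡⟨ cong (_+ (a + 2)) α∈F ⟩
    a * (x + y + z) + t + (a + 2)               ≡⟨ solve (a ∷ x ∷ y ∷ z ∷ t ∷ []) ⟩
    a * suc (x + y + z) + suc (suc t)           ∎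

bounds⇒InLen : ∀ {a r n} → a * n ≤ r → r ≤ (a + 2) * n → InLen a r n
bounds⇒InLen {a} {r} {n} lower upper =
  subst (λ s → InLen a s n) (m+[n∸m]≡n lower) (InLen-offset a n (r ∸ a * n) offset≤)
  where
  split : ∀ a n → (a + 2) * n ≡ a * n + n * 2
  split = solve-∀
  offset≤ : r ∸ a * n ≤ n * 2
  offset≤ = begin
    r ∸ a * n                 ≤⟨ ∸-monoˡ-≤ (a * n) upper ⟩
    (a + 2) * n ∸ a * n       ≡⟨ cong (_∸ a * n) (split a n) ⟩
    a * n + n * 2 ∸ a * n     ≡⟨ m+n∸m≡n (a * n) (n * 2) ⟩
    n * 2                     ∎
    where open ≤-Reasoning

interval-gap : ∀ {a m n} → 2 * m < a → m < n → (a + 2) * m < a * n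
interval-gap {a} {m} {n} 2m<a m<n = begin-strict
  (a + 2) * m     ≡⟨ solve (a ∷ m ∷ []) ⟩
  a * m + 2 * m   <⟨ +-monoʳ-< (a * m) 2m<a ⟩
  a * m + a       ≡⟨ solve (a ∷ m ∷ []) ⟩
  a * suc m       ≤⟨ *-monoʳ-≤ a m<n ⟩
  a * n           ∎
  where open ≤-Reasoning

InLen-≤ : ∀ {a r m n} → 2 * m < a → r ≤ (a + 2) * m → InLen a r n → n ≤ m
InLen-≤ 2m<a r≤ n∈L = ≮⇒≥ λ m<n →
  <⇒≱ (interval-gap 2m<a m<n) (≤-trans (proj₁ (InLen⇒bounds n∈L)) r≤)

InLen-unique : ∀ {a r ℓ n} → 2 * ℓ < a → InLen a r ℓ → InLen a r n → n ≡ ℓ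
InLen-unique {ℓ = ℓ} {n} 2ℓ<a ℓ∈L n∈L = ≤-antisym n≤ℓ ℓ≤n
  where
  n≤ℓ : n ≤ ℓ
  n≤ℓ = InLen-≤ 2ℓ<a (proj₂ (InLen⇒bounds ℓ∈L)) n∈L
  ℓ≤n : ℓ ≤ n
  ℓ≤n = InLen-≤ (≤-<-trans (*-monoʳ-≤ 2 n≤ℓ) 2ℓ<a) (proj₂ (InLen⇒bounds n∈L)) ℓ∈L

InSell⇒bounds : ∀ {a ℓ r} → InSell a ℓ r → a * ℓ ≤ r × r ≤ (a + 2) * ℓ
InSell⇒bounds {a} {r = r} ((α , α∈F) , only) =
  InLen⇒bounds (subst (InLen a r) (only (len α) (α , α∈F , refl)) (α , α∈F , refl))

bounds⇒InSell : ∀ {a ℓ r} → 2 * ℓ < a → a * ℓ ≤ r → r ≤ (a + 2) * ℓ → InSell a ℓ r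
bounds⇒InSell 2ℓ<a lower upper with bounds⇒InLen lower upper
... | ℓ∈L@(α , α∈F , _) = (α , α∈F) , λ n n∈L → InLen-unique 2ℓ<a ℓ∈L n∈L

InSell-functional : ∀ {a k k′ r} → InSell a k r → InSell a k′ r → k ≡ k′
InSell-functional ((α , α∈F) , only) (_ , only′) =
  trans (sym (only (len α) (α , α∈F , refl))) (only′ (len α) (α , α∈F , refl))

2*[n/2]<1+n : ∀ n → 2 * (n / 2) < suc n
2*[n/2]<1+n n = s≤s (subst (_≤ n) (*-comm (n / 2) 2) (m/n*n≤m n 2))

[m+2]*n<[n+2]*m : ∀ {m n} → n < m → (m + 2) * n < (n + 2) * m
[m+2]*n<[n+2]*m {m} {n} n<m =
  subst₂ _<_ (lhs m n) (rhs m n) (+-monoʳ-< (m * n) (*-monoʳ-< 2 n<m))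
  where
  lhs : ∀ m n → m * n + 2 * n ≡ (m + 2) * n
  lhs = solve-∀
  rhs : ∀ m n → m * n + 2 * m ≡ (n + 2) * m
  rhs = solve-∀

-- With k = a / 2: if a = 2k then L = k - 1 and 𝓛_a = k (a + 2); if a = 2k + 1 then L = k
-- and 𝓛_a = (k + 2) a.
scrL-bound : ∀ a′ → (suc a′ + 2) * (a′ / 2) < scrL (suc a′)
scrL-bound a′ with suc a′ % 2 | m≡m%n+[m/n]*n (suc a′) 2 | m%n<n (suc a′) 2
... | 0 | a≡k*2 | _ =
  subst ((a + 2) * L <_) (*-comm (a + 2) k) (*-monoʳ-< (a + 2) L<k)
  where
  a k L : ℕ
  a = suc a′
  k = a / 2
  L = a′ / 2
  L<k : L < k
  L<k = *-cancelʳ-< 2 L k (subst (L * 2 <_) a≡k*2 (s≤s (m/n*n≤m a′ 2)))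
... | 1 | a≡1+k*2 | _ =
  ≤-<-trans (*-monoʳ-≤ (a + 2) L≤k) ([m+2]*n<[n+2]*m k<a)
  where
  a k L : ℕ
  a = suc a′
  k = a / 2
  L = a′ / 2
  L≤k : L ≤ k
  L≤k = *-cancelʳ-≤ L k 2 (subst (L * 2 ≤_) (suc-injective a≡1+k*2) (m/n*n≤m a′ 2))
  k<a : k < a
  k<a = s≤s (subst (k ≤_) (sym (suc-injective a≡1+k*2)) (m≤m*n k 2))
... | suc (suc _) | _ | s≤s (s≤s ())

corollary3p3 : (a : ℕ) → 3 ≤ a → (ℓ : ℕ) → ℓ ≤ (a ∸ 1) / 2 →
    -- (1)
    ((a + 2) * ((a ∸ 1) / 2) < scrL a
      × (∀ r → InSell a ℓ r → InS a r × r < scrL a))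
    -- (2)
    × (∀ r → InSell a ℓ r ⇔ (a * ℓ ≤ r × r ≤ (a + 2) * ℓ))
    -- (3)
    × (∀ r → (InS a r × r ≤ (a + 2) * ((a ∸ 1) / 2))
             ⇔ ∃ (λ k → k ≤ (a ∸ 1) / 2 × InSell a k r))
    × (∀ k k′ → k ≤ (a ∸ 1) / 2 → k′ ≤ (a ∸ 1) / 2 → ¬ (k ≡ k′) →
         ∀ r → ¬ (InSell a k r × InSell a k′ r))
corollary3p3 zero ()
corollary3p3 (suc a′) _ ℓ ℓ≤L =
  (scrL-bound a′ , λ r s → proj₁ s , ≤-<-trans (InSell⇒≤top ℓ≤L s) (scrL-bound a′)) ,
  (λ r → mk⇔ InSell⇒bounds (uncurry (bounds⇒InSell (2k<a ℓ≤L)))) ,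
  (λ r → mk⇔ to from) ,
  λ k k′ _ _ k≢k′ r (s , s′) → k≢k′ (InSell-functional s s′)
  where
  a L : ℕ
  a = suc a′
  L = a′ / 2
  2k<a : ∀ {k} → k ≤ L → 2 * k < a
  2k<a k≤L = ≤-<-trans (*-monoʳ-≤ 2 k≤L) (2*[n/2]<1+n a′)
  InSell⇒≤top : ∀ {k r} → k ≤ L → InSell a k r → r ≤ (a + 2) * L
  InSell⇒≤top k≤L s = ≤-trans (proj₂ (InSell⇒bounds s)) (*-monoʳ-≤ (a + 2) k≤L)
  to : ∀ {r} → InS a r × r ≤ (a + 2) * L → ∃ λ k → k ≤ L × InSell a k r
  to ((α , α∈F) , r≤top) =
    len α , |α|≤L , uncurry (bounds⇒InSell (2k<a |α|≤L)) (InF⇒bounds α α∈F)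
    where
    |α|≤L : len α ≤ L
    |α|≤L = InLen-≤ (2k<a ≤-refl) r≤top (α , α∈F , refl)
  from : ∀ {r} → (∃ λ k → k ≤ L × InSell a k r) → InS a r × r ≤ (a + 2) * L
  from (k , k≤L , s) = proj₁ s , InSell⇒≤top k≤L s
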